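{- Let $\alpha\in\mathbf{H}$ and let $s_1,\ldots,s_n\in\mathbf{H}$ be such that $\alpha$ is not a subtree of any $s_i$ ($i\le n$) and $s_n\ne s_j$ for all $j<n$. Then for all $T\in\mathbf{H}$: $$T\in\mathbb{N}^{\alpha}_{\vec s}\iff T=\tfrac{1}{\alpha,\vec s}\ \vee\ \Big(\tfrac{2}{\alpha,\vec s}\sqsubseteq T\ \wedge\ T=\tfrac{1}{\alpha,\vec s}\Big[\alpha\mapsto T\big[\tfrac{2}{\alpha,\vec s}\mapsto\tfrac{1}{\alpha,\vec s}\big]\Big]\Big).$$
   Context: $\mathbf{H}$ is the set of finite full binary trees, i.e. variable-free terms built from a constant $\perp$ and a binary function $\langle\cdot,\cdot\rangle$; $\sqsubseteq$ is the subtree (subterm) relation. For $t,r,s\in\mathbf{H}$, $t[r\mapsto s]$ is the tree obtained by replacing each occurrence of $r$ in $t$ by $s$ (formally: $s$ if $t=r$; $\perp$ if $t\ne r$, $t=\perp$; $\langle t_1[r\mapsto s],t_2[r\mapsto s]\rangle$ if $t\ne r$, $t=\langle t_1,t_2\rangle$). Left-nested tuples: $\langle x_1\rangle=x_1$ and $\langle x_1,\ldots,x_m,x_{m+1}\rangle=\langle\langle x_1,\ldots,x_m\rangle,x_{m+1}\rangle$. For $\alpha,\vec s$ as in the claim define $\tfrac{1}{\alpha,\vec s}=\langle\alpha,s_1,\ldots,s_n\rangle$ and $\tfrac{m+1}{\alpha,\vec s}=\tfrac{1}{\alpha,\vec s}\big[\alpha\mapsto\tfrac{m}{\alpha,\vec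 s}\big]$, and $\mathbb{N}^\alpha_{\vec s}=\{\tfrac{m}{\alpha,\vec s}: m\in\mathbb{N},\ m\ge1\}$. -}

module Defs where

open import Data.Nat using (ℕ; zero; suc; _≥_)
open import Data.Fin using (Fin; inject₁; fromℕ; _<_)
open import Data.Vec using (Vec; foldl; lookup)
open import Data.Product using (∃; _×_)
open import Relation.Nullary using (Dec; yes; no; ¬_)
open import Relation.Binary.PropositionalEquality using (_≡_; refl; cong₂)

-- finite full binary trees: ⊥ and ⟨_,_⟩
data H : Set where
  leaf : H
  node : H → H → H

data _⊑_ : H → H → Set where
  ⊑-refl  : ∀ {t} → t ⊑ t
  ⊑-left  : ∀ {r t₁ t₂} → r ⊑ t₁ → r ⊑ node t₁ t₂
  ⊑-right : ∀ {r t₁ t₂} → r ⊑ t₂ → r ⊑ node t₁ t₂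

node-inj₁ : ∀ {a b c d} → node a b ≡ node c d → a ≡ c
node-inj₁ refl = refl

node-inj₂ : ∀ {a b c d} → node a b ≡ node c d → b ≡ d
node-inj₂ refl = refl

_≟H_ : (x y : H) → Dec (x ≡ y)
leaf ≟H leaf = yes refl
leaf ≟H node _ _ = no λ ()
node _ _ ≟H leaf = no λ ()
node a b ≟H node c d with a ≟H c | b ≟H d
... | yes refl | yes refl = yes refl
... | no ne | _ = no λ e → ne (node-inj₁ e)
... | yes _ | no ne = no λ e → ne (node-inj₂ e)

_[_↦_] : H → H → H → H
t [ r ↦ s ] with t ≟H r
... | yes _ = s
t [ r ↦ s ] | no _ with t
... | leaf = leaf
... | node t₁ t₂ = node (t₁ [ r ↦ s ]) (t₂ [ r ↦ s ])

-- left-nested tuple ⟨ α , s₁ , … , sₙ ⟩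
tuple : ∀ {n} → H → Vec H n → H
tuple α ss = foldl (λ _ → H) node α ss

-- frac m α s  =  m / (α, s⃗)   (defined for m ≥ 1; index k means m = k+1)
frac′ : ∀ {n} → ℕ → H → Vec H n → H
frac′ zero    α ss = tuple α ss
frac′ (suc k) α ss = tuple α ss [ α ↦ frac′ k α ss ]

frac : ∀ {n} → ℕ → H → Vec H n → H
frac zero    α ss = tuple α ss   -- junk value, never used (m ≥ 1)
frac (suc k) α ss = frac′ k α ss

InN : ∀ {n} → H → Vec H n → H → Set
InN α ss T = ∃ λ m → m ≥ 1 × T ≡ frac m α ss

-- With G X = ⟨X, s₁, …, sₙ⟩ and α fresh in every sᵢ, (m+1)/(α,s⃗) = G (m/(α,s⃗)), so
-- ℕ^α_s⃗ = {Gᵐ α : m ≥ 1} and R = 2/(α,s⃗) = G (G α). As sₙ differs from the other sᵢ, an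
-- occurrence of R in G X ≠ R lies inside X, so replacing R by G α commutes with G there.
-- Hence that replacement sends Gᵐ⁺¹ α to Gᵐ α (⇒), and a fixed point T ≠ R of
-- Φ T = G α [α ↦ T [R ↦ G α]] with R ⊑ T is G U for a smaller such fixed point U (⇐).
module Submission where

open import Defs
open import Data.Nat using (ℕ; suc)
open import Data.Fin using (Fin; inject₁; fromℕ; _<_)
open import Data.Vec using (Vec; lookup)
open import Data.Product using (_×_)
open import Data.Sum using (_⊎_)
open import Relation.Nullary using (¬_)
open import Relation.Binary.PropositionalEquality using (_≡_; _≢_)
open import Function.Bundles using (_⇔_)

open import Data.Nat as ℕ using (zero; _+_; _≤_; s≤s; z≤n)
open import Data.Nat.Properties using (≤-refl; ≤-trans; m≤m+n; m≤n+m; n≤1+n; <⇒≢)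
open import Data.Nat.Induction using (<-wellFounded)
open import Induction.WellFounded using (Acc; acc)
open import Data.Fin using (zero; suc; toℕ)
open import Data.Fin.Properties using (toℕ-fromℕ; inject₁ℕ<)
open import Data.Vec using ([]; _∷_; _∷ʳ_; initLast)
open import Data.Vec.Properties using (foldl-∷ʳ)
open import Data.Product using (∃; _,_)
open import Data.Sum using (inj₁; inj₂; [_,_]′)
open import Data.Empty using (⊥-elim)
open import Function using (_∘_)
open import Relation.Nullary using (Dec; yes; no)
open import Relation.Binary.PropositionalEquality
  using (refl; sym; trans; cong; cong₂; subst; module ≡-Reasoning)
open import Function.Bundles using (mk⇔)

open ≡-Reasoning

⊑-trans : ∀ {t u v} → t ⊑ u → u ⊑ v → t ⊑ v
⊑-trans p ⊑-refl      = p
⊑-trans p (⊑-left q)  = ⊑-left (⊑-trans p q)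
⊑-trans p (⊑-right q) = ⊑-right (⊑-trans p q)

⊑-node⁻ : ∀ {t u v} → t ⊑ node u v → t ≢ node u v → t ⊑ u ⊎ t ⊑ v
⊑-node⁻ ⊑-refl      t≢ = ⊥-elim (t≢ refl)
⊑-node⁻ (⊑-left p)  _  = inj₁ p
⊑-node⁻ (⊑-right p) _  = inj₂ p

size : H → ℕ
size leaf       = 1
size (node t u) = suc (size t + size u)

⊑⇒size≤ : ∀ {t u} → t ⊑ u → size t ≤ size u
⊑⇒size≤ ⊑-refl = ≤-refl
⊑⇒size≤ {u = node u v} (⊑-left p)  = ≤-trans (⊑⇒size≤ p) (≤-trans (m≤m+n (size u) (size v)) (n≤1+n _))
⊑⇒size≤ {u = node u v} (⊑-right p) = ≤-trans (⊑⇒size≤ p) (≤-trans (m≤n+m (size v) (size u)) (n≤1+n _))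

⊑⇒size<node : ∀ {t u v} → t ⊑ u → size t ℕ.< size (node u v)
⊑⇒size<node {u = u} {v} p = s≤s (≤-trans (⊑⇒size≤ p) (m≤m+n (size u) (size v)))

⊑⇒node≢ : ∀ {t u v} → t ⊑ u → node u v ≢ t
⊑⇒node≢ p e = <⇒≢ (⊑⇒size<node p) (cong size (sym e))

↦-self : ∀ r s → r [ r ↦ s ] ≡ s
↦-self r s with r ≟H r
... | yes _   = refl
... | no r≢r  = ⊥-elim (r≢r refl)

↦-node : ∀ {t u r} s → node t u ≢ r → node t u [ r ↦ s ] ≡ node (t [ r ↦ s ]) (u [ r ↦ s ])
↦-node {t} {u} {r} s t≢r with node t u ≟H r
... | yes t≡r = ⊥-elim (t≢r t≡r)
... | no _    = refl

↦-fresh : ∀ t {r} s → ¬ r ⊑ t → t [ r ↦ s ] ≡ t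
↦-fresh leaf {r} s r∉t with leaf ≟H r
... | yes refl = ⊥-elim (r∉t ⊑-refl)
... | no _     = refl
↦-fresh (node t u) {r} s r∉t with node t u ≟H r
... | yes refl = ⊥-elim (r∉t ⊑-refl)
... | no _     = cong₂ node (↦-fresh t s (r∉t ∘ ⊑-left)) (↦-fresh u s (r∉t ∘ ⊑-right))

⊑-tuple : ∀ {k} X (ys : Vec H k) → X ⊑ tuple X ys
⊑-tuple X []       = ⊑-refl
⊑-tuple X (y ∷ ys) = ⊑-trans (⊑-left ⊑-refl) (⊑-tuple (node X y) ys)

tuple-injective : ∀ {k} (ys : Vec H k) {X Y} → tuple X ys ≡ tuple Y ys → X ≡ Y
tuple-injective []       e = e
tuple-injective (y ∷ ys) e = node-inj₁ (tuple-injective ys e)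

-- The partial tuples ⟨X, y₁, …, yᵢ⟩ are the nodes node Y yᵢ with X ⊑ Y, so the
-- second hypothesis keeps r from matching any of them.
tuple-↦ : ∀ {k} (ys : Vec H k) {X r} s →
  (∀ i → ¬ r ⊑ lookup ys i) →
  (∀ i {Y} → X ⊑ Y → node Y (lookup ys i) ≢ r) →
  tuple X ys [ r ↦ s ] ≡ tuple (X [ r ↦ s ]) ys
tuple-↦ []       s _    _  = refl
tuple-↦ (y ∷ ys) {X} {r} s r∉ys r≢ = begin
  tuple (node X y) ys [ r ↦ s ]
    ≡⟨ tuple-↦ ys s (r∉ys ∘ suc) (λ i X⊑Y → r≢ (suc i) (⊑-trans (⊑-left ⊑-refl) X⊑Y)) ⟩
  tuple (node X y [ r ↦ s ]) ys
    ≡⟨ cong (λ Z → tuple Z ys) (↦-node s (r≢ zero ⊑-refl)) ⟩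
  tuple (node (X [ r ↦ s ]) (y [ r ↦ s ])) ys
    ≡⟨ cong (λ z → tuple (node (X [ r ↦ s ]) z) ys) (↦-fresh y s (r∉ys zero)) ⟩
  tuple (node (X [ r ↦ s ]) y) ys ∎

⊑-tuple⇒⊑ : ∀ {k} (ys : Vec H k) {X r} →
  (∀ i → ¬ r ⊑ lookup ys i) → (∀ i {Y} → node Y (lookup ys i) ≢ r) →
  r ⊑ tuple X ys → r ⊑ X
⊑-tuple⇒⊑ []       _    _  p = p
⊑-tuple⇒⊑ (y ∷ ys) r∉ys r≢ p with ⊑-tuple⇒⊑ ys (r∉ys ∘ suc) (λ i → r≢ (suc i)) p
... | ⊑-refl    = ⊥-elim (r≢ zero refl)
... | ⊑-left q  = q
... | ⊑-right q = ⊥-elim (r∉ys zero q)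

lookup-∷ʳ-fromℕ : ∀ {A : Set} {k} (xs : Vec A k) x → lookup (xs ∷ʳ x) (fromℕ k) ≡ x
lookup-∷ʳ-fromℕ []       x = refl
lookup-∷ʳ-fromℕ (_ ∷ xs) x = lookup-∷ʳ-fromℕ xs x

lookup-∷ʳ-inject₁ : ∀ {A : Set} {k} (xs : Vec A k) x i → lookup (xs ∷ʳ x) (inject₁ i) ≡ lookup xs i
lookup-∷ʳ-inject₁ (_ ∷ xs) x zero    = refl
lookup-∷ʳ-inject₁ (_ ∷ xs) x (suc i) = lookup-∷ʳ-inject₁ xs x i

inject₁<fromℕ : ∀ {k} (i : Fin k) → inject₁ i < fromℕ k
inject₁<fromℕ {k} i = subst (toℕ (inject₁ i) ℕ.<_) (sym (toℕ-fromℕ k)) (inject₁ℕ< i)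

module Iteration {k} (α : H) (ys : Vec H k) (y : H)
  (α∉ys : ∀ i → ¬ α ⊑ lookup ys i) (α∉y : ¬ α ⊑ y) (ys≢y : ∀ i → lookup ys i ≢ y) where

  s : Vec H (suc k)
  s = ys ∷ʳ y

  G : H → H
  G X = tuple X s

  G-unfold : ∀ X → G X ≡ node (tuple X ys) y
  G-unfold X = foldl-∷ʳ (λ _ → H) node X y ys

  ⊑-G : ∀ X → X ⊑ G X
  ⊑-G X = subst (X ⊑_) (sym (G-unfold X)) (⊑-left (⊑-tuple X ys))

  size<G : ∀ X → size X ℕ.< size (G X)
  size<G X = subst (λ Z → size X ℕ.< size Z) (sym (G-unfold X)) (⊑⇒size<node (⊑-tuple X ys))

  ⊑⇒G≢ : ∀ {X Y} → X ⊑ Y → G Y ≢ X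
  ⊑⇒G≢ {Y = Y} X⊑Y e = ⊑⇒node≢ (⊑-trans X⊑Y (⊑-tuple Y ys)) (trans (sym (G-unfold Y)) e)

  G-↦ : ∀ {X r} Z → G X ≢ r → ¬ r ⊑ y → (∀ i → ¬ r ⊑ lookup ys i) →
    (∀ i {Y} → X ⊑ Y → node Y (lookup ys i) ≢ r) →
    G X [ r ↦ Z ] ≡ G (X [ r ↦ Z ])
  G-↦ {X} {r} Z G≢r r∉y r∉ys r≢ = begin
    G X [ r ↦ Z ]                               ≡⟨ cong (_[ r ↦ Z ]) (G-unfold X) ⟩
    node (tuple X ys) y [ r ↦ Z ]               ≡⟨ ↦-node Z (G≢r ∘ trans (G-unfold X)) ⟩
    node (tuple X ys [ r ↦ Z ]) (y [ r ↦ Z ])   ≡⟨ cong₂ node (tuple-↦ ys Z r∉ys r≢) (↦-fresh y Z r∉y) ⟩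
    node (tuple (X [ r ↦ Z ]) ys) y             ≡⟨ sym (G-unfold (X [ r ↦ Z ])) ⟩
    G (X [ r ↦ Z ])                             ∎

  G-α↦ : ∀ Y → G α [ α ↦ Y ] ≡ G Y
  G-α↦ Y = trans (G-↦ Y (⊑⇒G≢ ⊑-refl) α∉y α∉ys (λ _ → ⊑⇒node≢)) (cong G (↦-self α Y))

  I : ℕ → H
  I j = frac′ j α s

  I-suc : ∀ j → I (suc j) ≡ G (I j)
  I-suc j = G-α↦ (I j)

  I⊑I-suc : ∀ j → I j ⊑ I (suc j)
  I⊑I-suc j = subst (I j ⊑_) (sym (I-suc j)) (⊑-G (I j))

  R : H
  R = I 1

  α⊑R : α ⊑ R
  α⊑R = ⊑-trans (⊑-G α) (I⊑I-suc 0)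

  R⊑I-suc : ∀ j → R ⊑ I (suc j)
  R⊑I-suc zero    = ⊑-refl
  R⊑I-suc (suc j) = ⊑-trans (R⊑I-suc j) (I⊑I-suc (suc j))

  R∉y : ¬ R ⊑ y
  R∉y = α∉y ∘ ⊑-trans α⊑R

  R∉ys : ∀ i → ¬ R ⊑ lookup ys i
  R∉ys i = α∉ys i ∘ ⊑-trans α⊑R

  -- R ends in y, which differs from every yᵢ.
  node≢R : ∀ i {Y} → node Y (lookup ys i) ≢ R
  node≢R i e = ys≢y i (node-inj₂ (trans e (trans (I-suc 0) (G-unfold (G α)))))

  G-R↦ : ∀ {X} Z → G X ≢ R → G X [ R ↦ Z ] ≡ G (X [ R ↦ Z ])
  G-R↦ Z G≢R = G-↦ Z G≢R R∉y R∉ys (λ i _ → node≢R i)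

  R⊑G⇒R⊑ : ∀ {X} → R ⊑ G X → R ≢ G X → R ⊑ X
  R⊑G⇒R⊑ {X} R⊑G R≢G =
    [ ⊑-tuple⇒⊑ ys R∉ys node≢R , ⊥-elim ∘ R∉y ]′
      (⊑-node⁻ (subst (R ⊑_) (G-unfold X) R⊑G) (R≢G ∘ λ e → trans e (sym (G-unfold X))))

  I-suc-R↦ : ∀ j → I (suc j) [ R ↦ G α ] ≡ I j
  I-suc-R↦ zero    = ↦-self R (G α)
  I-suc-R↦ (suc j) = begin
    I (suc (suc j)) [ R ↦ G α ]  ≡⟨ cong (_[ R ↦ G α ]) (I-suc (suc j)) ⟩
    G (I (suc j)) [ R ↦ G α ]    ≡⟨ G-R↦ (G α) (⊑⇒G≢ (R⊑I-suc j)) ⟩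
    G (I (suc j) [ R ↦ G α ])    ≡⟨ cong G (I-suc-R↦ j) ⟩
    G (I j)                      ≡⟨ sym (I-suc j) ⟩
    I (suc j)                    ∎

  Φ : H → H
  Φ T = G α [ α ↦ T [ R ↦ G α ] ]

  Φ-I-suc : ∀ j → Φ (I (suc j)) ≡ I (suc j)
  Φ-I-suc j = begin
    Φ (I (suc j))             ≡⟨ G-α↦ _ ⟩
    G (I (suc j) [ R ↦ G α ]) ≡⟨ cong G (I-suc-R↦ j) ⟩
    G (I j)                   ≡⟨ sym (I-suc j) ⟩
    I (suc j)                 ∎

  Φ-descent : ∀ {T} → R ⊑ T → T ≢ R → T ≡ Φ T →
    let U = T [ R ↦ G α ] in T ≡ G U × R ⊑ U × U ≡ Φ U
  Φ-descent {T} R⊑T T≢R T≡ΦT = T≡GU , R⊑U , U≡ΦU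
    where
    U = T [ R ↦ G α ]
    T≡GU : T ≡ G U
    T≡GU = trans T≡ΦT (G-α↦ U)
    GU≢R : G U ≢ R
    GU≢R = T≢R ∘ trans T≡GU
    R⊑U : R ⊑ U
    R⊑U = R⊑G⇒R⊑ (subst (R ⊑_) T≡GU R⊑T) (GU≢R ∘ sym)
    U≡ΦU : U ≡ Φ U
    U≡ΦU = begin
      T [ R ↦ G α ]              ≡⟨ cong (_[ R ↦ G α ]) T≡GU ⟩
      G U [ R ↦ G α ]            ≡⟨ G-R↦ (G α) GU≢R ⟩
      G (U [ R ↦ G α ])          ≡⟨ sym (G-α↦ _) ⟩
      Φ U                        ∎

  fixpoint⇒I : ∀ {T} → Acc ℕ._<_ (size T) → R ⊑ T → T ≡ Φ T → ∃ λ j → T ≡ I j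
  fixpoint⇒I {T} (acc rs) R⊑T T≡ΦT = by-cases (T ≟H R)
    where
    by-cases : Dec (T ≡ R) → ∃ λ j → T ≡ I j
    by-cases (yes T≡R) = 1 , T≡R
    by-cases (no T≢R)  =
      let T≡GU , R⊑U , U≡ΦU = Φ-descent R⊑T T≢R T≡ΦT
          U<T = subst (λ Z → size (T [ R ↦ G α ]) ℕ.< size Z) (sym T≡GU) (size<G _)
          j , U≡Ij = fixpoint⇒I (rs U<T) R⊑U U≡ΦU
      in suc j , trans T≡GU (trans (cong G U≡Ij) (sym (I-suc j)))

  InN⇔ : ∀ T → InN α s T ⇔ (T ≡ G α ⊎ (R ⊑ T × T ≡ Φ T))
  InN⇔ T = mk⇔ to from
    where
    to : InN α s T → T ≡ G α ⊎ (R ⊑ T × T ≡ Φ T)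
    to (suc zero    , _ , T≡) = inj₁ T≡
    to (suc (suc j) , _ , T≡) =
      inj₂ (subst (R ⊑_) (sym T≡) (R⊑I-suc j) , subst (λ Z → Z ≡ Φ Z) (sym T≡) (sym (Φ-I-suc j)))
    from : T ≡ G α ⊎ (R ⊑ T × T ≡ Φ T) → InN α s T
    from (inj₁ T≡)         = 1 , s≤s z≤n , T≡
    from (inj₂ (R⊑T , T≡)) =
      let j , T≡Ij = fixpoint⇒I (<-wellFounded (size T)) R⊑T T≡ in suc j , s≤s z≤n , T≡Ij

lemma1 : (n : ℕ) (α : H) (s : Vec H (suc n)) →
    (∀ i → ¬ (α ⊑ lookup s i)) →
    (∀ (j : Fin (suc n)) → j < fromℕ n → lookup s (fromℕ n) ≢ lookup s j) →
    ∀ (T : H) →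
      InN α s T ⇔
        (T ≡ frac 1 α s ⊎
          (frac 2 α s ⊑ T × T ≡ frac 1 α s [ α ↦ T [ frac 2 α s ↦ frac 1 α s ] ]))
lemma1 n α s α∉s last≢ T with initLast s
... | ys , y , refl = Iteration.InN⇔ α ys y α∉ys α∉y ys≢y T
  where
  α∉ys : ∀ i → ¬ α ⊑ lookup ys i
  α∉ys i = α∉s (inject₁ i) ∘ subst (α ⊑_) (sym (lookup-∷ʳ-inject₁ ys y i))
  α∉y : ¬ α ⊑ y
  α∉y = α∉s (fromℕ n) ∘ subst (α ⊑_) (sym (lookup-∷ʳ-fromℕ ys y))
  ys≢y : ∀ i → lookup ys i ≢ y
  ys≢y i e = last≢ (inject₁ i) (inject₁<fromℕ i)
    (trans (lookup-∷ʳ-fromℕ ys y) (sym (trans (lookup-∷ʳ-inject₁ ys y i) e)))
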